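{- Let $k\geq 2$ and let $X$ be a $k$-regular, $k$-edge-connected multigraph. A generalized truncation $Y$ of $X$ is $k$-edge-connected if and only if it is complete (every constituent is a complete graph).
   Context: A multigraph may have multiple edges but no loops; it is assumed to have no isolated vertices. Generalized truncation of $X$: take a matching $M_0$ with $|M_0|=|E(X)|$ (on $2|E(X)|$ new vertices) and a bijection $F:E(X)\to M_0$; for each edge $e$ of $X$ with ends $u,v$, label one end of $F(e)$ by $u$ and the other by $v$. For $v\in V(X)$, the cluster $\mathrm{cl}(v)$ is the set of vertices labelled $v$; insert an arbitrary graph $\mathrm{con}(v)$ (constituent) on $\mathrm{cl}(v)$. The result $F(M_0)\cup\bigcup_v\mathrm{con}(v)$ is a generalized truncation of $X$; it is complete if every constituent is a complete graph. A multigraph is $k$-edge-connected if every pair of distinct vertices is joined by $k$ mutually edge-disjoint paths. -}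

module Defs where

open import Data.Nat using (ℕ; _<_; _*_; _+_)
open import Data.Fin using (Fin; toℕ)
open import Data.Bool using (Bool; true; false; T; if_then_else_)
open import Data.List using (List; []; _∷_; length; filter; allFin)
open import Data.List.Membership.Propositional using (_∈_)
open import Data.List.Relation.Unary.Unique.Propositional using (Unique)
open import Data.Product using (Σ; Σ-syntax; _×_; _,_; proj₁; proj₂)
open import Data.Sum using (_⊎_; inj₁; inj₂)
open import Data.Empty using (⊥)
open import Relation.Nullary using (¬_; Dec)
open import Relation.Binary.PropositionalEquality using (_≡_; _≢_)
open import Data.Fin using (_≟_)
open import Relation.Nullary.Decidable using (_⊎-dec_)

-- General (multi)graphs: a vertex type, an edge type, and the ends of
-- each edge.  Parallel edges are distinct elements of E.

record Graph : Set₁ where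
  field
    V    : Set
    E    : Set
    ends : E → V × V
open Graph public

data Walk (G : Graph) : V G → V G → Set where
  nil  : ∀ {u} → Walk G u u
  cons : ∀ {u w v} (e : E G) →
         (ends G e ≡ (u , w) ⊎ ends G e ≡ (w , u)) →
         Walk G w v → Walk G u v

walkVertices : ∀ {G u v} → Walk G u v → List (V G)
walkVertices {u = u} nil = u ∷ []
walkVertices {u = u} (cons e _ p) = u ∷ walkVertices p

walkEdges : ∀ {G u v} → Walk G u v → List (E G)
walkEdges nil = []
walkEdges (cons e _ p) = e ∷ walkEdges p

Path : (G : Graph) → V G → V G → Set
Path G u v = Σ (Walk G u v) λ p → Unique (walkVertices p)

pathEdges : ∀ {G u v} → Path G u v → List (E G)
pathEdges p = walkEdges (proj₁ p)

KEdgeConnected : ℕ → Graph → Set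
KEdgeConnected k G =
  ∀ (u v : V G) → u ≢ v →
  Σ (Fin k → Path G u v) λ P →
    ∀ (i j : Fin k) → i ≢ j → ∀ (e : E G) →
      e ∈ pathEdges (P i) → e ∈ pathEdges (P j) → ⊥

record Multigraph (n m : ℕ) : Set where
  field
    ends     : Fin m → Fin n × Fin n
    loopless : ∀ e → proj₁ (ends e) ≢ proj₂ (ends e)
open Multigraph public

toGraph : ∀ {n m} → Multigraph n m → Graph
toGraph {n} {m} X = record { V = Fin n ; E = Fin m ; ends = Multigraph.ends X }

incident? : ∀ {n m} (X : Multigraph n m) (v : Fin n) (e : Fin m) →
  Dec (proj₁ (Multigraph.ends X e) ≡ v ⊎ proj₂ (Multigraph.ends X e) ≡ v)
incident? X v e = (proj₁ (Multigraph.ends X e) ≟ v) ⊎-dec (proj₂ (Multigraph.ends X e) ≟ v)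

-- degree = number of edges incident with v (no loops, so each counts once)
degree : ∀ {n m} → Multigraph n m → Fin n → ℕ
degree {m = m} X v = length (filter (incident? X v) (allFin m))

Regular : ∀ {n m} → Multigraph n m → ℕ → Set
Regular {n} X k = ∀ (v : Fin n) → degree X v ≡ k

NoIsolatedVertices : ∀ {n m} → Multigraph n m → Set
NoIsolatedVertices {n} {m} X = ∀ (v : Fin n) → Σ (Fin m) λ e →
  proj₁ (Multigraph.ends X e) ≡ v ⊎ proj₂ (Multigraph.ends X e) ≡ v

-- The matching M₀ is identified with E(X) via
-- the bijection F: the vertices of M₀ are the "darts" (e , b), where
-- (e , false) is the end of F(e) labelled by the first end of e and
-- (e , true) the end labelled by the second end of e.

Dart : ℕ → Set
Dart m = Fin m × Bool

label : ∀ {n m} → Multigraph n m → Dart m → Fin n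
label X (e , false) = proj₁ (Multigraph.ends X e)
label X (e , true)  = proj₂ (Multigraph.ends X e)

-- an injective numbering of darts, used to orient unordered pairs
dartCode : ∀ {m} → Dart m → ℕ
dartCode (e , b) = 2 * toℕ e + (if b then 1 else 0)

-- The constituents: a simple graph on each cluster cl(v), given jointly
-- as an adjacency relation on darts relating only darts of the same label.
record Constituents {n m : ℕ} (X : Multigraph n m) : Set where
  field
    adj       : Dart m → Dart m → Bool
    sym       : ∀ d d' → adj d d' ≡ adj d' d
    irrefl    : ∀ d → adj d d ≡ false
    inCluster : ∀ d d' → T (adj d d') → label X d ≡ label X d'
open Constituents public

truncation : ∀ {n m} (X : Multigraph n m) → Constituents X → Graph
truncation {n} {m} X C = record
  { V    = Dart m
  ; E    = Fin m ⊎ (Σ[ d ∈ Dart m ] Σ[ d' ∈ Dart m ]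
                      (dartCode d < dartCode d' × T (adj C d d')))
  ; ends = λ { (inj₁ e) → (e , false) , (e , true)
             ; (inj₂ (d , d' , _)) → d , d' }
  }

Complete : ∀ {n m} (X : Multigraph n m) → Constituents X → Set
Complete {n} {m} X C = ∀ (d d' : Dart m) → d ≢ d' →
  label X d ≡ label X d' → T (adj C d d')

module Submission where

-- If Y is k-edge-connected, take darts d ≠ d' of one cluster cl(u): the k edge-disjoint
-- d–d' paths leave d along distinct edges, and d has only the matching edge and its
-- neighbours among the other k − 1 darts of cl(u); so d' must be one of these neighbours.
-- Conversely, let the constituents be complete. Darts in different clusters are joined
-- by lifting k edge-disjoint paths of X: cross each edge of X by its matching edge and
-- move inside a cluster by a single constituent edge. For darts d ≠ d' of cl(u), some
-- path of X between the other ends of their edges avoids u (each of k paths through u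
-- would use two of the k edges at u); its lift, closed up by the matching edges of d
-- and d', is one path, and every other dart c of cl(u) gives the path d c d' (or d d').

open import Defs hiding (ends; sym; irrefl)
open import Data.Nat using (ℕ; zero; suc; _≤_; _<_; _+_; _*_; s≤s)
open import Data.Nat.Properties
  using (1+n≰n; +-suc; suc-injective; <-irrefl; <-asym; <-irrelevant; <-cmp)
open import Data.Fin using (Fin; zero; suc; toℕ; _≟_)
open import Data.Fin.Properties using (toℕ-injective; injective⇒≤; ¬∀⟶∃¬)
open import Data.Bool using (Bool; true; false; T; not; if_then_else_)
open import Data.Bool.Properties using (T-irrelevant) renaming (_≟_ to _≟ᵇ_)
open import Data.Product using (Σ; Σ-syntax; _×_; _,_; proj₁; proj₂; swap)
open import Data.Product.Properties using (≡-dec; ,-injective)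
open import Data.Sum using (_⊎_; inj₁; inj₂)
open import Data.Sum.Properties using (inj₁-injective)
open import Data.Empty using (⊥; ⊥-elim)
open import Data.List using (List; []; _∷_; _++_; filter; allFin; lookup)
open import Data.List.Membership.Propositional using (_∈_; _∉_)
open import Data.List.Membership.DecPropositional using () renaming (_∈?_ to ∈?)
open import Data.List.Membership.Propositional.Properties
  using (∈-filter⁺; ∈-allFin; ∈-++⁻; ∈-lookup)
open import Data.List.Relation.Unary.Any using (here; there; index)
open import Data.List.Relation.Unary.Any.Properties using (lookup-index)
import Data.List.Relation.Unary.All as All
open import Data.List.Relation.Unary.All.Properties using (¬Any⇒All¬; All¬⇒¬Any; all-filter)
open import Data.List.Relation.Unary.AllPairs using ([]; _∷_)
open import Data.List.Relation.Unary.Unique.Propositional using (Unique)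
open import Data.List.Relation.Unary.Unique.Propositional.Properties using (filter⁺; allFin⁺; ++⁺)
open import Data.Vec.Functional using () renaming (_∷_ to _◂_)
open import Function using (_∘_)
open import Function.Bundles using (_⇔_; mk⇔)
open import Function.Definitions using (Injective)
open import Relation.Binary using (tri<; tri≈; tri>)
open import Relation.Binary.PropositionalEquality
open import Relation.Nullary using (¬_; Dec; yes; no; does)
open import Relation.Nullary.Decidable using (T?)

Unique-∷ : ∀ {A : Set} {x : A} {xs} → x ∉ xs → Unique xs → Unique (x ∷ xs)
Unique-∷ x∉xs xs! = ¬Any⇒All¬ _ x∉xs ∷ xs!

Unique-head∉ : ∀ {A : Set} {x : A} {xs} → Unique (x ∷ xs) → x ∉ xs
Unique-head∉ (x≢xs ∷ _) = All¬⇒¬Any x≢xs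

Unique-lookup-injective : ∀ {A : Set} {xs : List A} → Unique xs →
  Injective _≡_ _≡_ (lookup xs)
Unique-lookup-injective {xs = x ∷ xs} _ {zero} {zero} _ = refl
Unique-lookup-injective {xs = x ∷ xs} xs! {zero} {suc j} eq =
  ⊥-elim (Unique-head∉ xs! (subst (_∈ xs) (sym eq) (∈-lookup j)))
Unique-lookup-injective {xs = x ∷ xs} xs! {suc i} {zero} eq =
  ⊥-elim (Unique-head∉ xs! (subst (_∈ xs) eq (∈-lookup i)))
Unique-lookup-injective {xs = x ∷ xs} (_ ∷ xs!) {suc i} {suc j} eq =
  cong suc (Unique-lookup-injective xs! eq)

◂-injective : ∀ {A : Set} {k} {a : A} {f : Fin k → A} →
  Injective _≡_ _≡_ f → (∀ i → f i ≢ a) → Injective _≡_ _≡_ (a ◂ f)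
◂-injective _ _ {zero} {zero} _ = refl
◂-injective _ f≢a {zero} {suc j} eq = ⊥-elim (f≢a j (sym eq))
◂-injective _ f≢a {suc i} {zero} eq = ⊥-elim (f≢a i eq)
◂-injective f-inj _ {suc i} {suc j} eq = cong suc (f-inj eq)

Joins : (G : Graph) → E G → V G → V G → Set
Joins G e x y = Graph.ends G e ≡ (x , y) ⊎ Graph.ends G e ≡ (y , x)

BothEnds : (G : Graph) → (V G → Set) → E G → Set
BothEnds G P e = P (proj₁ (Graph.ends G e)) × P (proj₂ (Graph.ends G e))

EdgeDisjoint : ∀ {G : Graph} {k u v} → (Fin k → Path G u v) → Set
EdgeDisjoint {G} {k} P =
  ∀ (i j : Fin k) → i ≢ j → ∀ (e : E G) →
    e ∈ pathEdges (P i) → e ∈ pathEdges (P j) → ⊥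

module _ {G : Graph} where

  joins-sym : ∀ {e x y} → Joins G e x y → Joins G e y x
  joins-sym (inj₁ p) = inj₂ p
  joins-sym (inj₂ p) = inj₁ p

  joins⇒bothEnds : ∀ (P : V G → Set) {e x y} → Joins G e x y → P x → P y → BothEnds G P e
  joins⇒bothEnds P (inj₁ p) px py rewrite p = px , py
  joins⇒bothEnds P (inj₂ p) px py rewrite p = py , px

  joins-endpoints : ∀ {e x y x' y'} → Joins G e x y → Joins G e x' y' →
    (x ≡ x' × y ≡ y') ⊎ (x ≡ y' × y ≡ x')
  joins-endpoints (inj₁ p) (inj₁ q) = inj₁ (,-injective (trans (sym p) q))
  joins-endpoints (inj₁ p) (inj₂ q) = inj₂ (,-injective (trans (sym p) q))
  joins-endpoints (inj₂ p) (inj₁ q) = inj₂ (swap (,-injective (trans (sym p) q)))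
  joins-endpoints (inj₂ p) (inj₂ q) = inj₁ (swap (,-injective (trans (sym p) q)))

  walk-start∈ : ∀ {u v} (w : Walk G u v) → u ∈ walkVertices w
  walk-start∈ nil = here refl
  walk-start∈ (cons _ _ _) = here refl

  walk-end∈ : ∀ {u v} (w : Walk G u v) → v ∈ walkVertices w
  walk-end∈ nil = here refl
  walk-end∈ (cons _ _ w) = there (walk-end∈ w)

  walkEdge-bothEnds : ∀ {u v} (w : Walk G u v) {e} → e ∈ walkEdges w →
    BothEnds G (_∈ walkVertices w) e
  walkEdge-bothEnds (cons e p w) (here refl) =
    joins⇒bothEnds (_∈ walkVertices (cons e p w)) p (here refl) (there (walk-start∈ w))
  walkEdge-bothEnds (cons e p w) (there e∈w) =
    let (x∈ , y∈) = walkEdge-bothEnds w e∈w in there x∈ , there y∈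

  walk-firstEdge : ∀ {x z} (w : Walk G x z) → x ≢ z →
    Σ (V G) λ y → Σ (E G) λ e → Joins G e x y × e ∈ walkEdges w
  walk-firstEdge nil x≢x = ⊥-elim (x≢x refl)
  walk-firstEdge (cons {w = y} e p _) _ = y , e , p , here refl

  snoc : ∀ {x y z} → Walk G x y → (e : E G) → Joins G e y z → Walk G x z
  snoc nil e p = cons e p nil
  snoc (cons e' p' w) e p = cons e' p' (snoc w e p)

  walkVertices-snoc : ∀ {x y z} (w : Walk G x y) e (p : Joins G e y z) →
    walkVertices (snoc w e p) ≡ walkVertices w ++ z ∷ []
  walkVertices-snoc nil e p = refl
  walkVertices-snoc (cons e' p' w) e p = cong (_ ∷_) (walkVertices-snoc w e p)

  walkEdges-snoc : ∀ {x y z} (w : Walk G x y) e (p : Joins G e y z) →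
    walkEdges (snoc w e p) ≡ walkEdges w ++ e ∷ []
  walkEdges-snoc nil e p = refl
  walkEdges-snoc (cons e' p' w) e p = cong (e' ∷_) (walkEdges-snoc w e p)

  sharedEdge⇒≡ : ∀ {k u v} (P : Fin k → Path G u v) → EdgeDisjoint P →
    ∀ i j {e} → e ∈ pathEdges (P i) → e ∈ pathEdges (P j) → i ≡ j
  sharedEdge⇒≡ _ disjoint i j e∈i e∈j with i ≟ j
  ... | yes i≡j = i≡j
  ... | no i≢j = ⊥-elim (disjoint i j i≢j _ e∈i e∈j)

partner : ∀ {m} → Dart m → Dart m
partner (e , b) = e , not b

_≟ᵈ_ : ∀ {m} (x y : Dart m) → Dec (x ≡ y)
_≟ᵈ_ = ≡-dec _≟_ _≟ᵇ_

private
  bitℕ : Bool → ℕ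
  bitℕ b = if b then 1 else 0

  double-suc : ∀ a r → 2 * suc a + r ≡ suc (suc (2 * a + r))
  double-suc a r = cong (λ t → suc t + r) (+-suc a (a + 0))

  bitℕ≢2+ : ∀ b t → bitℕ b ≢ suc (suc t)
  bitℕ≢2+ false t ()
  bitℕ≢2+ true t eq = case (suc-injective eq)
    where case : zero ≢ suc t
          case ()

  double+bit-injective : ∀ a a' b b' → 2 * a + bitℕ b ≡ 2 * a' + bitℕ b' → a ≡ a' × b ≡ b'
  double+bit-injective zero zero false false _ = refl , refl
  double+bit-injective zero zero true true _ = refl , refl
  double+bit-injective zero (suc a') b b' eq = ⊥-elim (bitℕ≢2+ b _ (trans eq (double-suc a' _)))
  double+bit-injective (suc a) zero b b' eq = ⊥-elim (bitℕ≢2+ b' _ (trans (sym eq) (double-suc a _)))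
  double+bit-injective (suc a) (suc a') b b' eq
    with double+bit-injective a a' b b'
           (suc-injective (suc-injective (trans (sym (double-suc a _)) (trans eq (double-suc a' _)))))
  ... | a≡a' , b≡b' = cong suc a≡a' , b≡b'

dartCode-injective : ∀ {m} {x y : Dart m} → dartCode x ≡ dartCode y → x ≡ y
dartCode-injective {x = e , b} {e' , b'} eq with double+bit-injective (toℕ e) (toℕ e') b b' eq
... | e≡e' , refl = cong (_, b) (toℕ-injective e≡e')

module _ {n m} (X : Multigraph n m) where

  private
    XG : Graph
    XG = toGraph X
    lab : Dart m → Fin n
    lab = label X

  Incident : Fin n → Fin m → Set
  Incident u e = proj₁ (Multigraph.ends X e) ≡ u ⊎ proj₂ (Multigraph.ends X e) ≡ u

  joins⇒incident : ∀ {e u w} → Joins XG e u w → Incident u e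
  joins⇒incident (inj₁ p) = inj₁ (cong proj₁ p)
  joins⇒incident (inj₂ p) = inj₂ (cong proj₂ p)

  incidentInjection⇒≤degree : ∀ {u j} (f : Fin j → Fin m) → (∀ i → Incident u (f i)) →
    Injective _≡_ _≡_ f → j ≤ degree X u
  incidentInjection⇒≤degree {u} f incident f-inj = injective⇒≤ position-injective
    where
      incidentEdges = filter (incident? X u) (allFin m)

      f∈ : ∀ i → f i ∈ incidentEdges
      f∈ i = ∈-filter⁺ (incident? X u) (∈-allFin (f i)) (incident i)

      position-injective : Injective _≡_ _≡_ (λ i → index (f∈ i))
      position-injective {i} {j} eq = f-inj (begin
        f i                                   ≡⟨ lookup-index (f∈ i) ⟩
        lookup incidentEdges (index (f∈ i))   ≡⟨ cong (lookup incidentEdges) eq ⟩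
        lookup incidentEdges (index (f∈ j))   ≡⟨ lookup-index (f∈ j) ⟨
        f j                                   ∎)
        where open ≡-Reasoning

  record IncidentPair (u : Fin n) (es : List (Fin m)) : Set where
    field
      first second    : Fin m
      first∈          : first ∈ es
      second∈         : second ∈ es
      first-incident  : Incident u first
      second-incident : Incident u second
      first≢second    : first ≢ second

  IncidentPair-there : ∀ {u e es} → IncidentPair u es → IncidentPair u (e ∷ es)
  IncidentPair-there p = record
    { first = first ; second = second ; first∈ = there first∈ ; second∈ = there second∈
    ; first-incident = first-incident ; second-incident = second-incident
    ; first≢second = first≢second
    }
    where open IncidentPair p

  path-innerVertex-incidentPair : ∀ {a b} (w : Walk XG a b) {u} → Unique (walkVertices w) →
    u ∈ walkVertices w → u ≢ a → u ≢ b → IncidentPair u (walkEdges w)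
  path-innerVertex-incidentPair nil _ (here u≡a) u≢a _ = ⊥-elim (u≢a u≡a)
  path-innerVertex-incidentPair (cons _ _ _) _ (here u≡a) u≢a _ = ⊥-elim (u≢a u≡a)
  path-innerVertex-incidentPair (cons {w = w} e p rest) {u} (_ ∷ rest!) (there u∈rest) _ u≢b
    with u ≟ w
  ... | no u≢w = IncidentPair-there (path-innerVertex-incidentPair rest rest! u∈rest u≢w u≢b)
  path-innerVertex-incidentPair (cons e p nil) _ (there _) _ u≢b | yes refl = ⊥-elim (u≢b refl)
  path-innerVertex-incidentPair (cons e p (cons e' p' rest)) w! (there _) _ _ | yes refl = record
    { first = e ; second = e' ; first∈ = here refl ; second∈ = there (here refl)
    ; first-incident = joins⇒incident (joins-sym {G = XG} p)
    ; second-incident = joins⇒incident p'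
    ; first≢second = e≢e'
    }
    where
      e≢e' : e ≢ e'
      e≢e' refl with joins-endpoints {G = XG} p p'
      ... | inj₁ (a≡w , _) = Unique-head∉ w! (here a≡w)
      ... | inj₂ (a≡x , _) = Unique-head∉ w! (there (subst (_∈ _) (sym a≡x) (walk-start∈ rest)))

  edgeDisjointPaths-avoid : ∀ {k u w w'} → degree X u ≡ suc k → w ≢ u → w' ≢ u →
    (P : Fin (suc k) → Path XG w w') → EdgeDisjoint P →
    ¬ (∀ i → u ∈ walkVertices (proj₁ (P i)))
  edgeDisjointPaths-avoid {k} {u} deg w≢u w'≢u P disjoint through =
    1+n≰n (subst (suc (suc k) ≤_) deg
      (incidentInjection⇒≤degree (second zero ◂ first) incident
        (◂-injective first-injective first≢second₀)))
    where
      pair : ∀ i → IncidentPair u (pathEdges (P i))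
      pair i = path-innerVertex-incidentPair (proj₁ (P i)) (proj₂ (P i)) (through i)
                 (λ u≡w → w≢u (sym u≡w)) (λ u≡w' → w'≢u (sym u≡w'))
      open module Pair i = IncidentPair (pair i)

      incident : ∀ i → Incident u ((second zero ◂ first) i)
      incident zero = second-incident zero
      incident (suc i) = first-incident i

      first-injective : Injective _≡_ _≡_ first
      first-injective {i} {j} eq =
        sharedEdge⇒≡ P disjoint i j (first∈ i) (subst (_∈ pathEdges (P j)) (sym eq) (first∈ j))

      first≢second₀ : ∀ i → first i ≢ second zero
      first≢second₀ i eq
        with sharedEdge⇒≡ P disjoint i zero (first∈ i)
               (subst (_∈ pathEdges (P zero)) (sym eq) (second∈ zero))
      ... | refl = first≢second zero eq

  avoidingPath : ∀ {k} → Regular X (suc k) → KEdgeConnected (suc k) XG →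
    ∀ {u w w'} → w ≢ u → w' ≢ u → Σ (Path XG w w') λ Q → u ∉ walkVertices (proj₁ Q)
  avoidingPath {k} regular connected {u} {w} {w'} w≢u w'≢u with w ≟ w'
  ... | yes refl = (nil , Unique-∷ (λ ()) []) , λ { (here u≡w) → w≢u (sym u≡w) }
  ... | no w≢w' =
    let (P , disjoint) = connected w w' w≢w'
        (i , u∉Pᵢ) = ¬∀⟶∃¬ (suc k) (λ i → u ∈ walkVertices (proj₁ (P i)))
                       (λ i → ∈? _≟_ u (walkVertices (proj₁ (P i))))
                       (edgeDisjointPaths-avoid (regular u) w≢u w'≢u P disjoint)
    in P i , u∉Pᵢ

  label-partner≢ : ∀ x → lab (partner x) ≢ lab x
  label-partner≢ (e , false) eq = loopless X e (sym eq)
  label-partner≢ (e , true) eq = loopless X e eq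

  sameEdge⇒≡ : ∀ {x y : Dart m} → proj₁ x ≡ proj₁ y → lab x ≡ lab y → x ≡ y
  sameEdge⇒≡ {e , false} {.e , false} refl _ = refl
  sameEdge⇒≡ {e , false} {.e , true} refl eq = ⊥-elim (loopless X e eq)
  sameEdge⇒≡ {e , true} {.e , false} refl eq = ⊥-elim (loopless X e (sym eq))
  sameEdge⇒≡ {e , true} {.e , true} refl _ = refl

  dart-incident : ∀ x {u} → lab x ≡ u → Incident u (proj₁ x)
  dart-incident (e , false) eq = inj₁ eq
  dart-incident (e , true) eq = inj₂ eq

  bothEnds-label : ∀ {P : Fin n → Set} x → BothEnds XG P (proj₁ x) → P (lab x)
  bothEnds-label (e , false) = proj₁
  bothEnds-label (e , true) = proj₂

  private
    entrySide : ∀ {e u w} → Joins XG e u w → Bool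
    entrySide (inj₁ _) = false
    entrySide (inj₂ _) = true

  entryDart : ∀ {e u w} → Joins XG e u w → Dart m
  entryDart {e} p = e , entrySide p

  label-entryDart : ∀ {e u w} (p : Joins XG e u w) → lab (entryDart p) ≡ u
  label-entryDart (inj₁ p) = cong proj₁ p
  label-entryDart (inj₂ p) = cong proj₂ p

  label-exitDart : ∀ {e u w} (p : Joins XG e u w) → lab (partner (entryDart p)) ≡ w
  label-exitDart (inj₁ p) = cong proj₂ p
  label-exitDart (inj₂ p) = cong proj₁ p

  dartAt : Fin n → Fin m → Dart m
  dartAt u e = e , not (does (proj₁ (Multigraph.ends X e) ≟ u))

  label-dartAt : ∀ {u e} → Incident u e → lab (dartAt u e) ≡ u
  label-dartAt {u} {e} incident with proj₁ (Multigraph.ends X e) ≟ u | incident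
  ... | yes first≡u | _ = first≡u
  ... | no first≢u | inj₁ first≡u = ⊥-elim (first≢u first≡u)
  ... | no _ | inj₂ second≡u = second≡u

  clusterDarts : ∀ {u j} → degree X u ≡ j →
    Σ (Fin j → Dart m) λ c → Injective _≡_ _≡_ c × ∀ i → lab (c i) ≡ u
  clusterDarts {u} refl =
    (λ i → dartAt u (lookup incidentEdges i)) ,
    (λ eq → Unique-lookup-injective (filter⁺ (incident? X u) (allFin⁺ m)) (cong proj₁ eq)) ,
    (λ i → label-dartAt (All.lookup (all-filter (incident? X u) (allFin m)) (∈-lookup i)))
    where incidentEdges = filter (incident? X u) (allFin m)

module _ {n m} {X : Multigraph n m} (C : Constituents X) where

  private
    Y : Graph
    Y = truncation X C
    lab : Dart m → Fin n
    lab = label X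

  matching-joins : ∀ x → Joins Y (inj₁ (proj₁ x)) x (partner x)
  matching-joins (e , false) = inj₁ refl
  matching-joins (e , true) = inj₂ refl

  matching-edge≡ : ∀ e {x y} → Joins Y (inj₁ e) x y → e ≡ proj₁ x
  matching-edge≡ e (inj₁ refl) = refl
  matching-edge≡ e (inj₂ refl) = refl

  matching-labels≢ : ∀ e {x y} → Joins Y (inj₁ e) x y → lab x ≢ lab y
  matching-labels≢ e (inj₁ refl) eq = loopless X e eq
  matching-labels≢ e (inj₂ refl) eq = loopless X e (sym eq)

  constituent-labels≡ : ∀ c {x y} → Joins Y (inj₂ c) x y → lab x ≡ lab y
  constituent-labels≡ (p , q , _ , pq) (inj₁ refl) = inCluster C p q pq
  constituent-labels≡ (p , q , _ , pq) (inj₂ refl) = sym (inCluster C p q pq)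

  constituent-adj : ∀ c {x y} → Joins Y (inj₂ c) x y → T (adj C x y)
  constituent-adj (p , q , _ , pq) (inj₁ refl) = pq
  constituent-adj (p , q , _ , pq) (inj₂ refl) = subst T (Constituents.sym C p q) pq

  joins⇒≢ : ∀ ε {x y} → Joins Y ε x y → x ≢ y
  joins⇒≢ (inj₁ e) j refl = matching-labels≢ e j refl
  joins⇒≢ (inj₂ (_ , _ , p<q , _)) (inj₁ refl) refl = <-irrefl refl p<q
  joins⇒≢ (inj₂ (_ , _ , p<q , _)) (inj₂ refl) refl = <-irrefl refl p<q

  joins-injective : ∀ ε ε' {x y} → Joins Y ε x y → Joins Y ε' x y → ε ≡ ε'
  joins-injective (inj₁ e) (inj₁ e') j j' =
    cong inj₁ (trans (matching-edge≡ e j) (sym (matching-edge≡ e' j')))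
  joins-injective (inj₁ e) (inj₂ c) j j' = ⊥-elim (matching-labels≢ e j (constituent-labels≡ c j'))
  joins-injective (inj₂ c) (inj₁ e) j j' = ⊥-elim (matching-labels≢ e j' (constituent-labels≡ c j))
  joins-injective (inj₂ (p , q , p<q , pq)) (inj₂ (_ , _ , p<q' , pq')) (inj₁ refl) (inj₁ refl) =
    cong (λ z → inj₂ (p , q , z)) (cong₂ _,_ (<-irrelevant p<q p<q') (T-irrelevant pq pq'))
  joins-injective (inj₂ (p , q , p<q , pq)) (inj₂ (_ , _ , p<q' , pq')) (inj₂ refl) (inj₂ refl) =
    cong (λ z → inj₂ (p , q , z)) (cong₂ _,_ (<-irrelevant p<q p<q') (T-irrelevant pq pq'))
  joins-injective (inj₂ (_ , _ , p<q , _)) (inj₂ (_ , _ , q<p , _)) (inj₁ refl) (inj₂ refl) =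
    ⊥-elim (<-asym p<q q<p)
  joins-injective (inj₂ (_ , _ , p<q , _)) (inj₂ (_ , _ , q<p , _)) (inj₂ refl) (inj₁ refl) =
    ⊥-elim (<-asym p<q q<p)

  module _ {d d' : Dart m} (d≢d' : d ≢ d') (same : lab d ≡ lab d') (nonadjacent : ¬ T (adj C d d'))
    where

    -- Each edge at d claims an edge of X at lab d other than proj₁ d: a constituent edge
    -- dy claims proj₁ y, the matching edge claims proj₁ d', which no constituent edge
    -- claims since d and d' are not adjacent.
    slot : ∀ {y} (ε : E Y) → Joins Y ε d y → Fin m
    slot (inj₁ _) _ = proj₁ d'
    slot {y} (inj₂ _) _ = proj₁ y

    slot-incident : ∀ {y} ε (j : Joins Y ε d y) → Incident X (lab d) (slot ε j)
    slot-incident (inj₁ _) _ = dart-incident X d' (sym same)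
    slot-incident {y} (inj₂ c) j = dart-incident X y (sym (constituent-labels≡ c j))

    slot≢ : ∀ {y} ε (j : Joins Y ε d y) → slot ε j ≢ proj₁ d
    slot≢ (inj₁ _) _ eq = d≢d' (sym (sameEdge⇒≡ X {d'} {d} eq (sym same)))
    slot≢ {y} (inj₂ c) j eq =
      joins⇒≢ (inj₂ c) j (sym (sameEdge⇒≡ X {y} {d} eq (sym (constituent-labels≡ c j))))

    slot-injective : ∀ {y y'} ε ε' (j : Joins Y ε d y) (j' : Joins Y ε' d y') →
      slot ε j ≡ slot ε' j' → ε ≡ ε'
    slot-injective (inj₁ e) (inj₁ e') j j' _ =
      cong inj₁ (trans (matching-edge≡ e j) (sym (matching-edge≡ e' j')))
    slot-injective {y' = y'} (inj₁ _) (inj₂ c) _ j' eq =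
      ⊥-elim (nonadjacent (subst (T ∘ adj C d)
        (sym (sameEdge⇒≡ X {d'} {y'} eq (trans (sym same) (constituent-labels≡ c j'))))
        (constituent-adj c j')))
    slot-injective {y} (inj₂ c) (inj₁ _) j _ eq =
      ⊥-elim (nonadjacent (subst (T ∘ adj C d)
        (sym (sameEdge⇒≡ X {d'} {y} (sym eq) (trans (sym same) (constituent-labels≡ c j))))
        (constituent-adj c j)))
    slot-injective {y} {y'} (inj₂ c) (inj₂ c') j j' eq
      with sameEdge⇒≡ X {y} {y'} eq (trans (sym (constituent-labels≡ c j)) (constituent-labels≡ c' j'))
    ... | refl = joins-injective (inj₂ c) (inj₂ c') j j'

    nonadjacent⇒¬edgeDisjoint : ∀ {k} → degree X (lab d) ≡ k →
      (P : Fin k → Path Y d d') → ¬ EdgeDisjoint P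
    nonadjacent⇒¬edgeDisjoint {k} deg P disjoint =
      1+n≰n (subst (suc k ≤_) deg
        (incidentInjection⇒≤degree X (proj₁ d ◂ pathSlot)
          (λ { zero → dart-incident X d refl ; (suc i) → slot-incident (edge i) (joinsᵢ i) })
          (◂-injective pathSlot-injective (λ i → slot≢ (edge i) (joinsᵢ i)))))
      where
        firstEdge = λ i → walk-firstEdge (proj₁ (P i)) d≢d'
        edge : Fin k → E Y
        edge i = proj₁ (proj₂ (firstEdge i))
        joinsᵢ : ∀ i → Joins Y (edge i) d (proj₁ (firstEdge i))
        joinsᵢ i = proj₁ (proj₂ (proj₂ (firstEdge i)))
        edge∈ : ∀ i → edge i ∈ pathEdges (P i)
        edge∈ i = proj₂ (proj₂ (proj₂ (firstEdge i)))

        pathSlot : Fin k → Fin m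
        pathSlot i = slot (edge i) (joinsᵢ i)

        pathSlot-injective : Injective _≡_ _≡_ pathSlot
        pathSlot-injective {i} {j} eq =
          sharedEdge⇒≡ P disjoint i j (edge∈ i)
            (subst (_∈ pathEdges (P j)) (sym (slot-injective _ _ (joinsᵢ i) (joinsᵢ j) eq)) (edge∈ j))

  completeIfConnected : ∀ {k} → Regular X k → KEdgeConnected k Y → Complete X C
  completeIfConnected regular connected d d' d≢d' same with T? (adj C d d')
  ... | yes adjacent = adjacent
  ... | no nonadjacent =
    let (P , disjoint) = connected d d' d≢d'
    in ⊥-elim (nonadjacent⇒¬edgeDisjoint d≢d' same nonadjacent (regular (lab d)) P disjoint)

module _ {n m} {X : Multigraph n m} {C : Constituents X} (complete : Complete X C) where

  private
    XG : Graph
    XG = toGraph X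
    Y : Graph
    Y = truncation X C
    lab : Dart m → Fin n
    lab = label X

  ConstituentEdge : Set
  ConstituentEdge = Σ[ p ∈ Dart m ] Σ[ q ∈ Dart m ] (dartCode p < dartCode q × T (adj C p q))

  constituentEdge : ∀ {x y} → x ≢ y → lab x ≡ lab y →
    Σ ConstituentEdge λ c → Joins Y (inj₂ c) x y
  constituentEdge {x} {y} x≢y same with <-cmp (dartCode x) (dartCode y)
  ... | tri< x<y _ _ = (x , y , x<y , complete x y x≢y same) , inj₁ refl
  ... | tri≈ _ codes≡ _ = ⊥-elim (x≢y (dartCode-injective codes≡))
  ... | tri> _ _ y<x = (y , x , y<x , complete y x (≢-sym x≢y) (sym same)) , inj₂ refl

  hop : ∀ {z} x a → lab x ≡ lab a → Walk Y a z → Walk Y x z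
  hop x a same w with x ≟ᵈ a
  ... | yes refl = w
  ... | no x≢a = let (c , j) = constituentEdge x≢a same in cons (inj₂ c) j w

  hop-vertex : ∀ {z} x a same (w : Walk Y a z) {t} →
    t ∈ walkVertices (hop x a same w) → t ≡ x ⊎ t ∈ walkVertices w
  hop-vertex x a same w t∈ with x ≟ᵈ a
  ... | yes refl = inj₂ t∈
  hop-vertex x a same w (here t≡x) | no _ = inj₁ t≡x
  hop-vertex x a same w (there t∈w) | no _ = inj₂ t∈w

  hop-matching : ∀ {z} x a same (w : Walk Y a z) {e} →
    inj₁ e ∈ walkEdges (hop x a same w) → inj₁ e ∈ walkEdges w
  hop-matching x a same w e∈ with x ≟ᵈ a
  ... | yes refl = e∈
  hop-matching x a same w (there e∈w) | no _ = e∈w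

  hop-unique : ∀ {z} x a same (w : Walk Y a z) → Unique (walkVertices w) →
    (x ≢ a → x ∉ walkVertices w) → Unique (walkVertices (hop x a same w))
  hop-unique x a same w w! x∉w with x ≟ᵈ a
  ... | yes refl = w!
  ... | no x≢a = Unique-∷ (x∉w x≢a) w!

  LiftDart : ∀ {u v} → Walk XG u v → Dart m → Dart m → Dart m → Set
  LiftDart W x y z = z ≡ x ⊎ z ≡ y ⊎ proj₁ z ∈ walkEdges W

  lift : ∀ {u v} (W : Walk XG u v) x y → lab x ≡ u → lab y ≡ v → Walk Y x y
  lift nil x y lx ly = hop x y (trans lx (sym ly)) nil
  lift (cons e p W) x y lx ly =
    hop x (entryDart X p) (trans lx (sym (label-entryDart X p)))
      (cons (inj₁ e) (matching-joins C (entryDart X p))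
        (lift W (partner (entryDart X p)) y (label-exitDart X p) ly))

  lift-vertex : ∀ {u v} (W : Walk XG u v) x y lx ly {z} →
    z ∈ walkVertices (lift W x y lx ly) → LiftDart W x y z
  lift-vertex nil x y lx ly z∈ with hop-vertex x y _ nil z∈
  ... | inj₁ z≡x = inj₁ z≡x
  ... | inj₂ (here z≡y) = inj₂ (inj₁ z≡y)
  lift-vertex (cons e p W) x y lx ly z∈ with hop-vertex x _ _ _ z∈
  ... | inj₁ z≡x = inj₁ z≡x
  ... | inj₂ (here refl) = inj₂ (inj₂ (here refl))
  ... | inj₂ (there z∈rest) with lift-vertex W _ y _ ly z∈rest
  ...   | inj₁ refl = inj₂ (inj₂ (here refl))
  ...   | inj₂ (inj₁ z≡y) = inj₂ (inj₁ z≡y)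
  ...   | inj₂ (inj₂ e∈W) = inj₂ (inj₂ (there e∈W))

  LiftDart-label : ∀ {u v} (W : Walk XG u v) {x y z} → lab x ≡ u → lab y ≡ v →
    LiftDart W x y z → lab z ∈ walkVertices W
  LiftDart-label W lx _ (inj₁ refl) = subst (_∈ walkVertices W) (sym lx) (walk-start∈ W)
  LiftDart-label W _ ly (inj₂ (inj₁ refl)) = subst (_∈ walkVertices W) (sym ly) (walk-end∈ W)
  LiftDart-label W {z = z} _ _ (inj₂ (inj₂ e∈W)) =
    bothEnds-label X {_∈ walkVertices W} z (walkEdge-bothEnds W e∈W)

  lift-matching : ∀ {u v} (W : Walk XG u v) x y lx ly {e} →
    inj₁ e ∈ walkEdges (lift W x y lx ly) → e ∈ walkEdges W
  lift-matching nil x y lx ly e∈ with hop-matching x y _ nil e∈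
  ... | ()
  lift-matching (cons e p W) x y lx ly e∈ with hop-matching x _ _ _ e∈
  ... | here eq = here (inj₁-injective eq)
  ... | there e∈rest = there (lift-matching W _ y _ ly e∈rest)

  lift-unique : ∀ {u v} (W : Walk XG u v) x y lx ly →
    Unique (walkVertices W) → Unique (walkVertices (lift W x y lx ly))
  lift-unique nil x y lx ly _ =
    hop-unique x y _ nil (Unique-∷ (λ ()) []) (λ { x≢y (here x≡y) → x≢y x≡y })
  lift-unique {u} (cons e p W) x y lx ly W!@(_ ∷ W!′) =
    hop-unique x a _ _
      (Unique-∷ (labelled-u∉rest (label-entryDart X p)) (lift-unique W _ y _ ly W!′)) x∉
    where
      a = entryDart X p
      rest = lift W (partner a) y (label-exitDart X p) ly
      labelled-u∉rest : ∀ {t} → lab t ≡ u → t ∉ walkVertices rest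
      labelled-u∉rest lt t∈ =
        Unique-head∉ W! (subst (_∈ walkVertices W) lt
          (LiftDart-label W (label-exitDart X p) ly (lift-vertex W _ y _ ly t∈)))
      x∉ : x ≢ a → x ∉ a ∷ walkVertices rest
      x∉ x≢a (here x≡a) = x≢a x≡a
      x∉ _ (there x∈) = labelled-u∉rest lx x∈

  liftPath : ∀ {u v} → Path XG u v → ∀ x y → lab x ≡ u → lab y ≡ v → Path Y x y
  liftPath (W , W!) x y lx ly = lift W x y lx ly , lift-unique W x y lx ly W!

  separateClusters : ∀ {k} → KEdgeConnected k XG → ∀ {x y} → lab x ≢ lab y →
    Σ (Fin k → Path Y x y) EdgeDisjoint
  separateClusters {k} connected {x} {y} lx≢ly = P , disjoint
    where
      W = proj₁ (connected (lab x) (lab y) lx≢ly)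
      W-disjoint = proj₂ (connected (lab x) (lab y) lx≢ly)

      P : Fin k → Path Y x y
      P i = liftPath (W i) x y refl refl

      sharedDart : ∀ {i j} → i ≢ j → ∀ {z} → z ∈ walkVertices (proj₁ (P i)) →
        z ∈ walkVertices (proj₁ (P j)) → z ≡ x ⊎ z ≡ y
      sharedDart {i} {j} i≢j z∈i z∈j
        with lift-vertex (proj₁ (W i)) x y refl refl z∈i | lift-vertex (proj₁ (W j)) x y refl refl z∈j
      ... | inj₁ z≡x | _ = inj₁ z≡x
      ... | inj₂ (inj₁ z≡y) | _ = inj₂ z≡y
      ... | inj₂ (inj₂ _) | inj₁ z≡x = inj₁ z≡x
      ... | inj₂ (inj₂ _) | inj₂ (inj₁ z≡y) = inj₂ z≡y
      ... | inj₂ (inj₂ e∈i) | inj₂ (inj₂ e∈j) = ⊥-elim (W-disjoint i j i≢j _ e∈i e∈j)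

      endpoints-labels≢ : ∀ {p q} → p ≡ x ⊎ p ≡ y → q ≡ x ⊎ q ≡ y → p ≢ q → lab p ≢ lab q
      endpoints-labels≢ (inj₁ refl) (inj₁ refl) p≢q _ = p≢q refl
      endpoints-labels≢ (inj₁ refl) (inj₂ refl) _ = lx≢ly
      endpoints-labels≢ (inj₂ refl) (inj₁ refl) _ eq = lx≢ly (sym eq)
      endpoints-labels≢ (inj₂ refl) (inj₂ refl) p≢q _ = p≢q refl

      disjoint : EdgeDisjoint P
      disjoint i j i≢j (inj₁ e) e∈i e∈j =
        W-disjoint i j i≢j e (lift-matching (proj₁ (W i)) x y refl refl e∈i)
                             (lift-matching (proj₁ (W j)) x y refl refl e∈j)
      disjoint i j i≢j (inj₂ c@(p , q , _ , pq)) c∈i c∈j =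
        let (p∈i , q∈i) = walkEdge-bothEnds (proj₁ (P i)) c∈i
            (p∈j , q∈j) = walkEdge-bothEnds (proj₁ (P j)) c∈j
        in endpoints-labels≢ (sharedDart i≢j p∈i p∈j) (sharedDart i≢j q∈i q∈j)
             (joins⇒≢ C (inj₂ c) (inj₁ refl)) (inCluster C p q pq)

  InCluster : Fin n → E Y → Set
  InCluster u = BothEnds Y (λ z → lab z ≡ u)

  matching-¬InCluster : ∀ e {u} → ¬ InCluster u (inj₁ e)
  matching-¬InCluster e (first≡u , second≡u) = loopless X e (trans first≡u (sym second≡u))

  edgePath : ∀ {x y} → x ≢ y → lab x ≡ lab y → Path Y x y
  edgePath x≢y same =
    cons (inj₂ (proj₁ (constituentEdge x≢y same))) (proj₂ (constituentEdge x≢y same)) nil ,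
    Unique-∷ (λ { (here x≡y) → x≢y x≡y }) (Unique-∷ (λ ()) [])

  edgePath-joins : ∀ {x y} x≢y same {ε} → ε ∈ pathEdges (edgePath {x} {y} x≢y same) →
    Joins Y ε x y
  edgePath-joins x≢y same (here refl) = proj₂ (constituentEdge x≢y same)

  module _ {d d' : Dart m} (d≢d' : d ≢ d') (same : lab d ≡ lab d') where

    clusterPath : ∀ c → c ≢ d → lab c ≡ lab d → Path Y d d'
    clusterPath c c≢d lc with c ≟ᵈ d'
    ... | yes refl = edgePath d≢d' same
    ... | no c≢d' =
      cons (inj₂ (proj₁ first)) (proj₂ first) rest ,
      Unique-∷ (λ { (here d≡c) → c≢d (sym d≡c) ; (there (here d≡d')) → d≢d' d≡d' }) rest!
      where
        first = constituentEdge (≢-sym c≢d) (sym lc)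
        rest = proj₁ (edgePath c≢d' (trans lc same))
        rest! = proj₂ (edgePath c≢d' (trans lc same))

    clusterPath-joins : ∀ c c≢d lc {ε} → ε ∈ pathEdges (clusterPath c c≢d lc) →
      Joins Y ε d c ⊎ Joins Y ε c d'
    clusterPath-joins c c≢d lc ε∈ with c ≟ᵈ d'
    ... | yes refl = inj₁ (edgePath-joins d≢d' same ε∈)
    clusterPath-joins c c≢d lc (here refl) | no c≢d' =
      inj₁ (proj₂ (constituentEdge (≢-sym c≢d) (sym lc)))
    clusterPath-joins c c≢d lc (there ε∈) | no c≢d' = inj₂ (edgePath-joins c≢d' (trans lc same) ε∈)

    clusterPath-inCluster : ∀ c c≢d lc {ε} → ε ∈ pathEdges (clusterPath c c≢d lc) →
      InCluster (lab d) ε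
    clusterPath-inCluster c c≢d lc ε∈ with clusterPath-joins c c≢d lc ε∈
    ... | inj₁ j = joins⇒bothEnds {G = Y} (λ z → lab z ≡ lab d) j refl lc
    ... | inj₂ j = joins⇒bothEnds {G = Y} (λ z → lab z ≡ lab d) j lc (sym same)

    clusterPaths-disjoint : ∀ {c c'} c≢d c'≢d lc lc' → c ≢ c' → ∀ {ε} →
      ε ∈ pathEdges (clusterPath c c≢d lc) → ε ∈ pathEdges (clusterPath c' c'≢d lc') → ⊥
    clusterPaths-disjoint {c} {c'} c≢d c'≢d lc lc' c≢c' ε∈ ε∈'
      with clusterPath-joins c c≢d lc ε∈ | clusterPath-joins c' c'≢d lc' ε∈'
    ... | inj₁ j | inj₁ j' with joins-endpoints {G = Y} j j'
    ...   | inj₁ (_ , c≡c') = c≢c' c≡c'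
    ...   | inj₂ (d≡c' , _) = c'≢d (sym d≡c')
    clusterPaths-disjoint _ c'≢d _ _ _ _ _ | inj₁ j | inj₂ j' with joins-endpoints {G = Y} j j'
    ...   | inj₁ (d≡c' , _) = c'≢d (sym d≡c')
    ...   | inj₂ (d≡d' , _) = d≢d' d≡d'
    clusterPaths-disjoint c≢d _ _ _ _ _ _ | inj₂ j | inj₁ j' with joins-endpoints {G = Y} j j'
    ...   | inj₁ (c≡d , _) = c≢d c≡d
    ...   | inj₂ (_ , d'≡d) = d≢d' (sym d'≡d)
    clusterPaths-disjoint _ _ _ _ c≢c' _ _ | inj₂ j | inj₂ j' with joins-endpoints {G = Y} j j'
    ...   | inj₁ (c≡c' , _) = c≢c' c≡c'
    ...   | inj₂ (c≡d' , d'≡c') = c≢c' (trans c≡d' d'≡c')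

    module _ (Q : Path XG (lab (partner d)) (lab (partner d')))
             (u∉Q : lab d ∉ walkVertices (proj₁ Q)) where

      private
        middle : Walk Y (partner d) (partner d')
        middle = lift (proj₁ Q) (partner d) (partner d') refl refl

        middle-avoids : ∀ {t} → t ∈ walkVertices middle → lab t ≢ lab d
        middle-avoids t∈ eq =
          u∉Q (subst (_∈ walkVertices (proj₁ Q)) eq
            (LiftDart-label (proj₁ Q) refl refl (lift-vertex (proj₁ Q) _ _ refl refl t∈)))

        lastStep : Joins Y (inj₁ (proj₁ d')) (partner d') d'
        lastStep = joins-sym {G = Y} {e = inj₁ (proj₁ d')} (matching-joins C d')

      outerPath : Path Y d d'
      outerPath =
        cons (inj₁ (proj₁ d)) (matching-joins C d) (snoc middle (inj₁ (proj₁ d')) lastStep) ,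
        subst (λ vs → Unique (d ∷ vs)) (sym (walkVertices-snoc middle _ lastStep))
          (Unique-∷ d∉ (++⁺ (lift-unique (proj₁ Q) _ _ refl refl (proj₂ Q)) (Unique-∷ (λ ()) [])
                          λ { (t∈ , here refl) → middle-avoids t∈ (sym same) }))
        where
          d∉ : d ∉ walkVertices middle ++ d' ∷ []
          d∉ d∈ with ∈-++⁻ (walkVertices middle) d∈
          ... | inj₁ d∈middle = middle-avoids d∈middle refl
          ... | inj₂ (here d≡d') = d≢d' d≡d'

      outerPath-¬inCluster : ∀ {ε} → ε ∈ pathEdges outerPath → ¬ InCluster (lab d) ε
      outerPath-¬inCluster (here refl) = matching-¬InCluster (proj₁ d)
      outerPath-¬inCluster (there ε∈)
        with ∈-++⁻ (walkEdges middle) (subst (_ ∈_) (walkEdges-snoc middle _ lastStep) ε∈)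
      ... | inj₁ ε∈middle = λ (first≡u , _) →
        middle-avoids (proj₁ (walkEdge-bothEnds middle ε∈middle)) first≡u
      ... | inj₂ (here refl) = matching-¬InCluster (proj₁ d')

      pathVia : ∀ c → lab c ≡ lab d → Dec (c ≡ d) → Path Y d d'
      pathVia c _ (yes _) = outerPath
      pathVia c lc (no c≢d) = clusterPath c c≢d lc

      pathVia-disjoint : ∀ {c c'} lc lc' (c≟d : Dec (c ≡ d)) (c'≟d : Dec (c' ≡ d)) → c ≢ c' →
        ∀ {ε} → ε ∈ pathEdges (pathVia c lc c≟d) → ε ∈ pathEdges (pathVia c' lc' c'≟d) → ⊥
      pathVia-disjoint _ _ (yes refl) (yes refl) c≢c' _ _ = c≢c' refl
      pathVia-disjoint _ lc' (yes _) (no c'≢d) _ ε∈ ε∈' =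
        outerPath-¬inCluster ε∈ (clusterPath-inCluster _ c'≢d lc' ε∈')
      pathVia-disjoint lc _ (no c≢d) (yes _) _ ε∈ ε∈' =
        outerPath-¬inCluster ε∈' (clusterPath-inCluster _ c≢d lc ε∈)
      pathVia-disjoint lc lc' (no c≢d) (no c'≢d) c≢c' ε∈ ε∈' =
        clusterPaths-disjoint c≢d c'≢d lc lc' c≢c' ε∈ ε∈'

  sameCluster : ∀ {k} → Regular X (suc k) → KEdgeConnected (suc k) XG → ∀ {d d'} → d ≢ d' →
    lab d ≡ lab d' → Σ (Fin (suc k) → Path Y d d') EdgeDisjoint
  sameCluster {k} regular connected {d} {d'} d≢d' same =
    (λ i → pathVia d≢d' same Q u∉Q (c i) (c-label i) (c i ≟ᵈ d)) ,
    (λ i j i≢j _ → pathVia-disjoint d≢d' same Q u∉Q (c-label i) (c-label j)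
                     (c i ≟ᵈ d) (c j ≟ᵈ d) (λ cᵢ≡cⱼ → i≢j (c-injective cᵢ≡cⱼ)))
    where
      avoiding = avoidingPath X regular connected (label-partner≢ X d)
                   (λ eq → label-partner≢ X d' (trans eq same))
      Q = proj₁ avoiding
      u∉Q = proj₂ avoiding
      cluster = clusterDarts X (regular (lab d))
      c = proj₁ cluster
      c-injective = proj₁ (proj₂ cluster)
      c-label = proj₂ (proj₂ cluster)

  connectedIfComplete : ∀ {k} → Regular X (suc k) → KEdgeConnected (suc k) XG →
    KEdgeConnected (suc k) Y
  connectedIfComplete regular connected x y x≢y with lab x ≟ lab y
  ... | yes same = sameCluster regular connected x≢y same
  ... | no lx≢ly = separateClusters connected lx≢ly

corollary3p7 : ∀ {n m : ℕ} (X : Multigraph n m) (k : ℕ) → 2 ≤ k →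
    NoIsolatedVertices X → Regular X k → KEdgeConnected k (toGraph X) →
    (C : Constituents X) →
    KEdgeConnected k (truncation X C) ⇔ Complete X C
corollary3p7 X (suc k) (s≤s _) _ regular connected C =
  mk⇔ (completeIfConnected C regular) (λ complete → connectedIfComplete complete regular connected)
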